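{- Let $L$ be a non-normal modal logic that does not contain axiom C. Then $L$ has the polysize model property with respect to bi-neighbourhood models: there is a polynomial $p$ such that if a formula $A$ of size $n$ is satisfiable in some bi-neighbourhood model for $L$, then it is satisfiable in a bi-neighbourhood model for $L$ of size at most $p(n)$.
   Context: The language $\mathcal L$ has formulas $A ::= p\mid\bot\mid\top\mid A\land A\mid A\lor A\mid A\to A\mid \Box A$ over countably many propositional variables, with $\neg A:=A\to\bot$, $A\leftrightarrow B:=(A\to B)\land(B\to A)$. A non-normal modal logic $L$ is axiomatised by classical propositional logic with modus ponens, the rule RE (from $A\leftrightarrow B$ infer $\Box A\leftrightarrow\Box B$), plus any selection of: M: $\Box(A\land B)\to\Box A$; C: $\Box A\land\Box B\to\Box(A\land B)$; N: $\Box\top$; T: $\Box A\to A$; D: $\neg(\Box A\land\Box\neg A)$; P: $\neg\Box\bot$; rules RD$_n^+$ ($n\ge1$): from $\neg(A_1\land\dots\land A_n)$ infer $\neg(\Box A_1\land\dots\land\Box A_n)$. Here C is not among the selected axioms. A bi-neighbourhood model is $\langle\mathcal W,\mathcal N,\mathcal V\rangle$ with $\mathcal W\neq\emptyset$, $\mathcal N(w)\subseteq\mathcal P(\mathcal W)\times\mathcal P(\mathcal W)$, $\mathcal V$ a valuation; forcing is classical on propositional connectives and $w\Vdash\Box A$ iff there is $(\alpha,\beta)\in\mathcal N(w)$ with $\alpha\subseteq[\![A]\!]\subseteq\mathcal W\setminus\beta$, where $[\![A]\!]=\{v\mid v\Vdash A\}$. The bi-neighbourhood models for $L$ are those satisfying,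 for each axiom/rule X of $L$ besides RE, the condition (X) (for all $w$): (M) if $(\alpha,\beta)\in\mathcal N(w)$ then $\beta=\emptyset$; (N) there is $\alpha\subseteq\mathcal W$ with $(\alpha,\emptyset)\in\mathcal N(w)$ for all $w$; (T) if $(\alpha,\beta)\in\mathcal N(w)$ then $w\in\alpha$; (P) if $(\alpha,\beta)\in\mathcal N(w)$ then $\alpha\neq\emptyset$; (D) if $(\alpha,\beta),(\gamma,\delta)\in\mathcal N(w)$ then $\alpha\cap\gamma\neq\emptyset$ or $\beta\cap\delta\neq\emptyset$; (RD$_n^+$) if $(\alpha_1,\beta_1),\dots,(\alpha_n,\beta_n)\in\mathcal N(w)$ then $\alpha_1\cap\dots\cap\alpha_n\neq\emptyset$. A formula is satisfiable in a model if it is forced at some world. The size of a model $\mathcal M=\langle\mathcal W,\mathcal N,\mathcal V\rangle$ is $|\mathcal W|+\sum_{w\in\mathcal W}|\mathcal N(w)|$. The polynomial $p$ may depend on $L$. -}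

module Defs where

open import Data.Nat using (ℕ; zero; suc; _+_; _*_; _^_; _≤_)
open import Data.Bool using (Bool; true; false; T)
open import Data.Fin using (Fin)
open import Data.Product using (Σ; _×_; _,_; proj₁; proj₂; ∃)
open import Data.Sum using (_⊎_)
open import Data.List using (List; []; _∷_)
open import Relation.Binary.PropositionalEquality using (_≡_)
import Data.Empty as E
import Data.Unit as U

data Fm : Set where
  var  : ℕ → Fm
  ⊥'   : Fm
  ⊤'   : Fm
  _∧'_ : Fm → Fm → Fm
  _∨'_ : Fm → Fm → Fm
  _⇒_  : Fm → Fm → Fm
  □_   : Fm → Fm

size : Fm → ℕ
size (var _)  = 1
size ⊥'       = 1
size ⊤'       = 1
size (a ∧' b) = suc (size a + size b)
size (a ∨' b) = suc (size a + size b)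
size (a ⇒ b)  = suc (size a + size b)
size (□ a)    = suc (size a)

-- A non-normal modal logic without C: a selection of M, N, T, D, P
-- and of the rules RD⁺_n (n ≥ 1); rdPlus k selects RD⁺_(k+1).

record Logic : Set where
  field
    axM axN axT axD axP : Bool
    rdPlus : ℕ → Bool

-- Bi-neighbourhood models.  Subsets of W are classical: W → Bool.
-- N(w) is given as a family of pairs (α , β) indexed by Idx w
-- (a set of pairs is the image of such a family).

Subset : Set → Set
Subset W = W → Bool

record Model : Set₁ where
  field
    W   : Set
    Idx : W → Set
    nb  : (w : W) → Idx w → Subset W × Subset W
    V   : W → ℕ → Bool

module _ (M : Model) where
  open Model M

  Forces : W → Fm → Set
  Forces w (var p)  = V w p ≡ true
  Forces w ⊥'       = E.⊥
  Forces w ⊤'       = U.⊤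
  Forces w (a ∧' b) = Forces w a × Forces w b
  Forces w (a ∨' b) = Forces w a ⊎ Forces w b
  Forces w (a ⇒ b)  = Forces w a → Forces w b
  Forces w (□ a)    = Σ (Idx w) λ i →
      ((v : W) → proj₁ (nb w i) v ≡ true → Forces v a)
    × ((v : W) → Forces v a → proj₂ (nb w i) v ≡ false)

  CondM : Set
  CondM = (w : W) (i : Idx w) (v : W) → proj₂ (nb w i) v ≡ false

  CondN : Set
  CondN = (w : W) → Σ (Idx w) λ i → (v : W) → proj₂ (nb w i) v ≡ false

  CondT : Set
  CondT = (w : W) (i : Idx w) → proj₁ (nb w i) w ≡ true

  CondP : Set
  CondP = (w : W) (i : Idx w) → Σ W λ v → proj₁ (nb w i) v ≡ true

  CondD : Set
  CondD = (w : W) (i j : Idx w) →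
      (Σ W λ v → (proj₁ (nb w i) v ≡ true) × (proj₁ (nb w j) v ≡ true))
    ⊎ (Σ W λ v → (proj₂ (nb w i) v ≡ true) × (proj₂ (nb w j) v ≡ true))

  CondRD : ℕ → Set
  CondRD n = (w : W) (is : Fin n → Idx w) →
    Σ W λ v → (k : Fin n) → proj₁ (nb w (is k)) v ≡ true

  ModelFor : Logic → Set
  ModelFor L =
      (T axM → CondM) × (T axN → CondN) × (T axT → CondT)
    × (T axD → CondD) × (T axP → CondP)
    × ((k : ℕ) → T (rdPlus k) → CondRD (suc k))
    where open Logic L

record FinModel : Set where
  field
    k  : ℕ
    m  : Fin k → ℕ
    nb : (w : Fin k) → Fin (m w) → Subset (Fin k) × Subset (Fin k)
    V  : Fin k → ℕ → Bool

toModel : FinModel → Model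
toModel F = record { W = Fin k ; Idx = λ w → Fin (m w) ; nb = nb ; V = V }
  where open FinModel F

sumFin : (k : ℕ) → (Fin k → ℕ) → ℕ
sumFin zero    f = 0
sumFin (suc k) f = f Fin.zero + sumFin k (λ i → f (Fin.suc i))

modelSize : FinModel → ℕ
modelSize F = FinModel.k F + sumFin (FinModel.k F) (FinModel.m F)

-- Polynomials with natural-number coefficients (c₀ ∷ c₁ ∷ …)

Poly : Set
Poly = List ℕ

evalPoly : Poly → ℕ → ℕ
evalPoly []       x = 0
evalPoly (c ∷ cs) x = c + x * evalPoly cs x

module Submission where

-- Let Φ = {⊤} ∪ {B | □B occurs in A}, t = |A|, and let K ≥ 2 bound the number of constraints
-- that must be met at once (2 for D, n + 1 for RD⁺ₙ when the arities of the RD⁺ rules are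
-- bounded).  For every set of at most K signed members of Φ that is satisfiable in the given
-- model pick a world G j satisfying it.  The small model has t + 1 layers: column 0 starts at w₀,
-- column j + 1 at G j, and each world copies a world of the given model.  A world i at height
-- h < t gets one bi-neighbourhood for every B ∈ Φ with origin(i) ⊨ □B, namely the worlds of
-- height ≤ h + 1 satisfying resp. refuting B (the second part is empty under M); the last layer
-- only gets ({i}, ∅).  As the copies of the G j sit at height 0, they witness every failure of
-- [B] ⊆ [D] or [D] ⊆ [B] inside the window of i, so □ is evaluated correctly at i for formulas
-- of size ≤ t − h; they also realise D, P and bounded RD.  If the arities of the RD⁺ rules are
-- unbounded, the world above i copies a world satisfying all boxed arguments of origin(i).
-- There are (t + 1)(1 + (2|Φ|)^K) worlds with at most |Φ| neighbourhoods each.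

open import Defs
open import Level using (0ℓ)
open import Axiom.ExcludedMiddle using (ExcludedMiddle)
open import Axiom.DoubleNegationElimination using (em⇒dne)
open import Data.Bool using (Bool; true; false; T)
open import Data.Bool.Properties using (T?)
open import Data.Empty using (⊥-elim)
open import Data.Fin as Fin using (Fin; toℕ; fromℕ<; inject≤; combine; remQuot)
open import Data.Fin.Properties using (toℕ-injective; toℕ-fromℕ<; toℕ-inject≤; toℕ<n; remQuot-combine)
open import Data.List using (List; []; _∷_; [_]; _++_; map; length; lookup; replicate; filter; tabulate; cartesianProductWith)
open import Data.List.Properties using (length-++; length-map; length-replicate; length-filter; length-tabulate)
open import Data.List.Membership.Propositional using (_∈_)
open import Data.List.Membership.Propositional.Properties using (∈-cartesianProductWith⁺; ∈-++⁺ˡ; ∈-++⁺ʳ; ∈-map⁺; ∈-filter⁺; ∈-filter⁻; ∈-lookup)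
open import Data.List.Relation.Binary.Subset.Propositional using (_⊆_)
open import Data.List.Relation.Binary.Subset.Propositional.Properties using (xs⊆xs++ys; xs⊆ys++xs)
open import Data.List.Relation.Unary.All as All using (All; []; _∷_)
open import Data.List.Relation.Unary.All.Properties using (++⁺; ++⁻ˡ; replicate⁺; tabulate⁺; tabulate⁻)
open import Data.List.Relation.Unary.Any using (here; there; index)
open import Data.List.Relation.Unary.Any.Properties using (lookup-index)
open import Data.Nat using (ℕ; zero; suc; _+_; _*_; _^_; _∸_; _⊓_; _≤_; _<_; z≤n; s≤s; s≤s⁻¹; _<?_)
open import Data.Nat.GeneralisedArithmetic using (fold)
open import Data.Nat.Properties
open import Data.Nat.Solver using (module +-*-Solver)
open import Data.Product using (Σ; ∃-syntax; _×_; _,_; proj₁; proj₂)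
open import Data.Product.Function.NonDependent.Propositional using (_×-⇔_)
open import Data.Sum using (_⊎_; inj₁; inj₂)
open import Data.Sum.Function.Propositional using (_⊎-⇔_)
open import Function using (_∘_; _⇔_; mk⇔; Equivalence)
open import Function.Construct.Identity using (⇔-id)
open import Function.Related.TypeIsomorphisms using (→-cong-⇔)
open import Relation.Binary.PropositionalEquality using (_≡_; refl; sym; trans; cong; cong₂; subst; module ≡-Reasoning)
open import Relation.Nullary using (Dec; yes; no; ¬_; does)
open import Relation.Nullary.Decidable using (dec-true)

open Equivalence using (to; from)
open +-*-Solver

tuples : ∀ {X : Set} → ℕ → List X → List (List X)
tuples zero    xs = [ [] ]
tuples (suc n) xs = cartesianProductWith _∷_ xs (tuples n xs)

∈-tuples : ∀ {X : Set} {xs : List X} {n ys} → length ys ≡ n → All (_∈ xs) ys → ys ∈ tuples n xs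
∈-tuples {n = zero}  {[]}     _  []            = here refl
∈-tuples {n = suc n} {y ∷ ys} eq (y∈ ∷ ys⊆) = ∈-cartesianProductWith⁺ _∷_ y∈ (∈-tuples (suc-injective eq) ys⊆)

length-cartesianProductWith : ∀ {X Y Z : Set} (f : X → Y → Z) xs ys →
  length (cartesianProductWith f xs ys) ≡ length xs * length ys
length-cartesianProductWith f []       ys = refl
length-cartesianProductWith f (x ∷ xs) ys = begin
  length (map (f x) ys ++ cartesianProductWith f xs ys)
    ≡⟨ length-++ (map (f x) ys) ⟩
  length (map (f x) ys) + length (cartesianProductWith f xs ys)
    ≡⟨ cong₂ _+_ (length-map (f x) ys) (length-cartesianProductWith f xs ys) ⟩
  length ys + length xs * length ys ∎
  where open ≡-Reasoning

length-tuples : ∀ {X : Set} n (xs : List X) → length (tuples n xs) ≡ length xs ^ n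
length-tuples zero    xs = refl
length-tuples (suc n) xs =
  trans (length-cartesianProductWith _∷_ xs (tuples n xs)) (cong (length xs *_) (length-tuples n xs))

padWith : ∀ {X : Set} → X → ℕ → List X → List X
padWith x n xs = xs ++ replicate (n ∸ length xs) x

length-padWith : ∀ {X : Set} {x : X} {n xs} → length xs ≤ n → length (padWith x n xs) ≡ n
length-padWith {n = n} {xs} le =
  trans (length-++ xs) (trans (cong (length xs +_) (length-replicate (n ∸ length xs))) (m+[n∸m]≡n le))

All-padWith : ∀ {X : Set} {P : X → Set} {x n xs} → P x → All P xs → All P (padWith x n xs)
All-padWith {n = n} {xs} px pxs = ++⁺ pxs (replicate⁺ (n ∸ length xs) px)

length-++-≤ : ∀ {X : Set} (xs ys : List X) {m n} → length xs ≤ m → length ys ≤ n → length (xs ++ ys) ≤ m + n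
length-++-≤ xs ys p q = ≤-trans (≤-reflexive (length-++ xs)) (+-mono-≤ p q)

module _ (em : ExcludedMiddle 0ℓ) {W : Set} where

  opaque
    χ : (W → Set) → Subset W
    χ P v = does (em {P v})

  opaque
    unfolding χ

    χ-true : ∀ {P v} → P v → χ P v ≡ true
    χ-true = dec-true em

    χ-true⁻ : ∀ {P v} → χ P v ≡ true → P v
    χ-true⁻ {P} {v} eq with em {P v}
    ... | yes p = p

    χ-false : ∀ {P v} → ¬ P v → χ P v ≡ false
    χ-false {P} {v} ¬p with em {P v}
    ... | yes p = ⊥-elim (¬p p)
    ... | no _  = refl

  witness : W → (W → Set) → W
  witness w P with em {Σ W P}
  ... | yes (v , _) = v
  ... | no _        = w

  witness-satisfies : ∀ w P → Σ W P → P (witness w P)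
  witness-satisfies w P ∃P with em {Σ W P}
  ... | yes (_ , p) = p
  ... | no ¬∃P      = ⊥-elim (¬∃P ∃P)

sumFin-≤ : ∀ k (f : Fin k → ℕ) {a} → (∀ i → f i ≤ a) → sumFin k f ≤ k * a
sumFin-≤ zero    f bound = z≤n
sumFin-≤ (suc k) f bound = +-mono-≤ (bound Fin.zero) (sumFin-≤ k (f ∘ Fin.suc) (bound ∘ Fin.suc))

monomial : ℕ → ℕ → Poly
monomial c d = replicate d 0 ++ [ c ]

evalPoly-monomial : ∀ c d x → evalPoly (monomial c d) x ≡ c * x ^ d
evalPoly-monomial c zero    x = solve 2 (λ c x → c :+ x :* con 0 := c :* con 1) refl c x
evalPoly-monomial c (suc d) x =
  trans (cong (x *_) (evalPoly-monomial c d x))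
        (solve 3 (λ c x y → x :* (c :* y) := c :* (x :* y)) refl c x (x ^ d))

*-^-distrib : ∀ m n d → (m * n) ^ d ≡ m ^ d * n ^ d
*-^-distrib m n zero    = refl
*-^-distrib m n (suc d) = trans (cong (m * n *_) (*-^-distrib m n d))
  (solve 4 (λ m n x y → m :* n :* (x :* y) := m :* x :* (n :* y)) refl m n (m ^ d) (n ^ d))

suc-^-≤ : ∀ x n → 1 ≤ n → suc (x ^ n) ≤ suc x ^ n
suc-^-≤ x (suc n) _ = +-mono-≤ (m^n>0 (suc x) n) (*-monoʳ-≤ x (^-monoˡ-≤ n (n≤1+n x)))

3+2t≤5t : ∀ t → 1 ≤ t → suc (suc t + suc t) ≤ 5 * t
3+2t≤5t (suc t) _ = ≤-trans (m≤m+n (suc (suc (suc t) + suc (suc t))) (3 * t)) (≤-reflexive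
  (solve 1 (λ t → (con 1 :+ ((con 1 :+ (con 1 :+ t)) :+ (con 1 :+ (con 1 :+ t)))) :+ con 3 :* t
                  := con 5 :* (con 1 :+ t)) refl t))

boxArgs : Fm → List Fm
boxArgs (var _)  = []
boxArgs ⊥'       = []
boxArgs ⊤'       = []
boxArgs (a ∧' b) = boxArgs a ++ boxArgs b
boxArgs (a ∨' b) = boxArgs a ++ boxArgs b
boxArgs (a ⇒ b)  = boxArgs a ++ boxArgs b
boxArgs (□ a)    = a ∷ boxArgs a

length-boxArgs : ∀ D → length (boxArgs D) ≤ size D
length-boxArgs (var _)  = z≤n
length-boxArgs ⊥'       = z≤n
length-boxArgs ⊤'       = z≤n
length-boxArgs (a ∧' b) = m≤n⇒m≤1+n (length-++-≤ (boxArgs a) (boxArgs b) (length-boxArgs a) (length-boxArgs b))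
length-boxArgs (a ∨' b) = m≤n⇒m≤1+n (length-++-≤ (boxArgs a) (boxArgs b) (length-boxArgs a) (length-boxArgs b))
length-boxArgs (a ⇒ b)  = m≤n⇒m≤1+n (length-++-≤ (boxArgs a) (boxArgs b) (length-boxArgs a) (length-boxArgs b))
length-boxArgs (□ a)    = s≤s (length-boxArgs a)

size-pos : ∀ D → 1 ≤ size D
size-pos (var _)  = s≤s z≤n
size-pos ⊥'       = s≤s z≤n
size-pos ⊤'       = s≤s z≤n
size-pos (_ ∧' _) = s≤s z≤n
size-pos (_ ∨' _) = s≤s z≤n
size-pos (_ ⇒ _)  = s≤s z≤n
size-pos (□ _)    = s≤s z≤n

budget-left : ∀ h a b {t} → h + suc (a + b) ≤ t → h + a ≤ t
budget-left h a b = ≤-trans (+-monoʳ-≤ h (m≤n⇒m≤1+n (m≤m+n a b)))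

budget-right : ∀ h a b {t} → h + suc (a + b) ≤ t → h + b ≤ t
budget-right h a b = ≤-trans (+-monoʳ-≤ h (m≤n⇒m≤1+n (m≤n+m b a)))

budget-□ : ∀ h s {t} → h + suc s ≤ t → h < t
budget-□ h s {t} bud = ≤-trans (s≤s (m≤m+n h s)) (subst (_≤ t) (+-suc h s) bud)

budget-next : ∀ h s {h′ t} → h′ ≤ suc h → h + suc s ≤ t → h′ + s ≤ t
budget-next h s {t = t} h′≤ bud = ≤-trans (+-monoˡ-≤ s h′≤) (subst (_≤ t) (+-suc h s) bud)

module _ (M : Model) where
  open Model M

  Sandwich : Subset W × Subset W → Fm → Set
  Sandwich (α , β) D =
    ((v : W) → α v ≡ true → Forces M v D) × ((v : W) → Forces M v D → β v ≡ false)

  CondRD-≤ : ∀ {m n} → m ≤ suc n → CondRD M (suc n) → (w : W) (is : Fin m → Idx w) →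
             Σ W λ v → (c : Fin m) → proj₁ (nb w (is c)) v ≡ true
  CondRD-≤ {zero}          _  _  w is = w , λ ()
  CondRD-≤ {suc m} {n} m≤n rd w is =
    v , λ c → subst (λ c′ → proj₁ (nb w (is c′)) v ≡ true) (clamp-inject≤ c) (v∈ (inject≤ c m≤n))
    where
    clamp : Fin (suc n) → Fin (suc m)
    clamp c = fromℕ< (s≤s (m⊓n≤n (toℕ c) m))

    clamp-inject≤ : ∀ c → clamp (inject≤ c m≤n) ≡ c
    clamp-inject≤ c = toℕ-injective (begin
      toℕ (clamp (inject≤ c m≤n)) ≡⟨ toℕ-fromℕ< (s≤s (m⊓n≤n (toℕ (inject≤ c m≤n)) m)) ⟩
      toℕ (inject≤ c m≤n) ⊓ m     ≡⟨ cong (_⊓ m) (toℕ-inject≤ c m≤n) ⟩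
      toℕ c ⊓ m                   ≡⟨ m≤n⇒m⊓n≡m (s≤s⁻¹ (toℕ<n c)) ⟩
      toℕ c                       ∎)
      where open ≡-Reasoning

    v : W
    v = proj₁ (rd w (is ∘ clamp))

    v∈ : (c : Fin (suc n)) → proj₁ (nb w (is (clamp c))) v ≡ true
    v∈ = proj₂ (rd w (is ∘ clamp))

RDBoundedBy : Logic → ℕ → Set
RDBoundedBy L K = ∀ n → T (Logic.rdPlus L n) → suc n ≤ K

RDUnbounded : Logic → Set
RDUnbounded L = ∀ N → ∃[ n ] N ≤ n × T (Logic.rdPlus L n)

rdProfile : ExcludedMiddle 0ℓ → (L : Logic) → ∃[ K ] 2 ≤ K × (RDBoundedBy L K ⊎ RDUnbounded L)
rdProfile em L with em {∃[ K ] RDBoundedBy L K}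
... | yes (K , bounded) = 2 + K , m≤m+n 2 K , inj₁ λ n rd → ≤-trans (bounded n rd) (m≤n+m K 2)
... | no ¬bounded       = 2 , ≤-refl , inj₂ λ N → em⇒dne em λ ¬above →
  ¬bounded (N , λ n rd → ≰⇒> λ N≤n → ¬above (n , N≤n , rd))

module Construction
  (em : ExcludedMiddle 0ℓ) (L : Logic) (K : ℕ) (2≤K : 2 ≤ K)
  (rd : RDBoundedBy L K ⊎ RDUnbounded L)
  (A : Fm) (M : Model) (w₀ : Model.W M)
  (condM : T (Logic.axM L) → CondM M) (condN : T (Logic.axN L) → CondN M)
  (condT : T (Logic.axT L) → CondT M) (condD : T (Logic.axD L) → CondD M)
  (condP : T (Logic.axP L) → CondP M)
  (condRD : ∀ n → T (Logic.rdPlus L n) → CondRD M (suc n))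
  where

  open Logic L
  open Model M using (W) renaming (nb to nbᴹ)

  t : ℕ
  t = size A

  args : List Fm
  args = ⊤' ∷ boxArgs A

  Sat : W → Bool × Fm → Set
  Sat y (true  , B) = Forces M y B
  Sat y (false , B) = ¬ Forces M y B

  signed : Bool → Fm → Bool × Fm
  signed s B = s , B

  signedArgs : List (Bool × Fm)
  signedArgs = map (signed true) args ++ map (signed false) args

  ∈-signedArgs : ∀ s {B} → B ∈ args → (s , B) ∈ signedArgs
  ∈-signedArgs true  B∈ = ∈-++⁺ˡ (∈-map⁺ (signed true) B∈)
  ∈-signedArgs false B∈ = ∈-++⁺ʳ (map (signed true) args) (∈-map⁺ (signed false) B∈)

  length-signedArgs : length signedArgs ≡ length args + length args
  length-signedArgs = trans (length-++ (map (signed true) args))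
    (cong₂ _+_ (length-map (signed true) args) (length-map (signed false) args))

  opaque
    requirements : List (List (Bool × Fm))
    requirements = tuples K signedArgs

    g : ℕ
    g = length requirements

    G : Fin g → W
    G j = witness em w₀ (λ y → All (Sat y) (lookup requirements j))

    G-realises : ∀ {e es} → length (e ∷ es) ≤ K → All (_∈ signedArgs) (e ∷ es) →
                 (Σ W λ y → All (Sat y) (e ∷ es)) → Σ (Fin g) λ j → All (Sat (G j)) (e ∷ es)
    G-realises {e} {es} len mem (y , sat) = j , ++⁻ˡ (e ∷ es) (subst (All (Sat (G j))) (sym r≡) realised)
      where
      r : List (Bool × Fm)
      r = padWith e K (e ∷ es)

      r∈ : r ∈ requirements
      r∈ = ∈-tuples (length-padWith {x = e} {n = K} {xs = e ∷ es} len) (All-padWith {n = K} (All.head mem) mem)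

      j : Fin g
      j = index r∈

      r≡ : r ≡ lookup requirements j
      r≡ = lookup-index r∈

      realised : All (Sat (G j)) (lookup requirements j)
      realised = witness-satisfies em w₀ (λ y → All (Sat y) (lookup requirements j))
        (y , subst (All (Sat y)) r≡ (All-padWith {n = K} (All.head sat) sat))

    g≡ : g ≡ (length args + length args) ^ K
    g≡ = trans (length-tuples K signedArgs) (cong (_^ K) length-signedArgs)

  realise₂ : ∀ {y} s B s′ D → B ∈ args → D ∈ args → Sat y (s , B) → Sat y (s′ , D) →
             Σ (Fin g) λ j → Sat (G j) (s , B) × Sat (G j) (s′ , D)
  realise₂ s B s′ D B∈ D∈ yB yD
    with G-realises 2≤K (∈-signedArgs s B∈ ∷ ∈-signedArgs s′ D∈ ∷ []) (_ , yB ∷ yD ∷ [])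
  ... | j , GB ∷ GD ∷ [] = j , GB , GD

  realiseAll : ∀ {n} (B : Fin (suc n) → Fm) → suc n ≤ K → (∀ c → B c ∈ args) →
               (Σ W λ y → ∀ c → Forces M y (B c)) → Σ (Fin g) λ j → ∀ c → Forces M (G j) (B c)
  realiseAll B n<K B∈ (y , yB) =
    let (j , GB) = G-realises {signed true (B Fin.zero)} {tabulate (signed true ∘ B ∘ Fin.suc)}
                     (≤-trans (≤-reflexive (length-tabulate (signed true ∘ B))) n<K)
                     (tabulate⁺ {f = signed true ∘ B} (∈-signedArgs true ∘ B∈))
                     (y , tabulate⁺ {f = signed true ∘ B} yB)
    in j , tabulate⁻ {f = signed true ∘ B} GB

  opaque
    boxed? : ∀ x B → Dec (Forces M x (□ B))
    boxed? x B = em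

    boxedAt : W → List Fm
    boxedAt x = filter (boxed? x) args

    boxedAt⊆args : ∀ x c → lookup (boxedAt x) c ∈ args
    boxedAt⊆args x c = proj₁ (∈-filter⁻ (boxed? x) {xs = args} (∈-lookup c))

    boxedAt-□ : ∀ x c → Forces M x (□ (lookup (boxedAt x) c))
    boxedAt-□ x c = proj₂ (∈-filter⁻ (boxed? x) {xs = args} (∈-lookup c))

    index-boxedAt : ∀ x {B} → B ∈ args → Forces M x (□ B) →
                    Σ (Fin (length (boxedAt x))) λ c → lookup (boxedAt x) c ≡ B
    index-boxedAt x {B} B∈ □B = index mem , sym (lookup-index mem)
      where
      mem : B ∈ boxedAt x
      mem = ∈-filter⁺ (boxed? x) B∈ □B

    length-boxedAt : ∀ x → length (boxedAt x) ≤ length args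
    length-boxedAt x = length-filter (boxed? x) args

  -- Only meaningful when the arities of the RD⁺ rules are unbounded; otherwise any choice works.
  successor : W → W
  successor x = witness em x (λ y → All (Forces M y) (boxedAt x))

  successor-forces : RDUnbounded L → ∀ x → All (Forces M (successor x)) (boxedAt x)
  successor-forces unbounded x with unbounded (length args)
  ... | n , args≤n , rdn with CondRD-≤ M (≤-trans (length-boxedAt x) (m≤n⇒m≤1+n args≤n))
                                        (condRD n rdn) x (λ c → proj₁ (boxedAt-□ x c))
  ... | y , y∈ = witness-satisfies em x (λ y → All (Forces M y) (boxedAt x)) (y , All.tabulate λ mem →
    subst (Forces M y) (sym (lookup-index mem))
          (proj₁ (proj₂ (boxedAt-□ x (index mem))) y (y∈ (index mem))))

  k : ℕ
  k = suc t * suc g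

  world : Fin (suc t) → Fin (suc g) → Fin k
  world = combine {suc t} {suc g}

  height : Fin k → ℕ
  height i = toℕ (proj₁ (remQuot {suc t} (suc g) i))

  column : Fin k → Fin (suc g)
  column i = proj₂ (remQuot {suc t} (suc g) i)

  base : Fin (suc g) → W
  base Fin.zero    = w₀
  base (Fin.suc j) = G j

  origin : Fin k → W
  origin i = fold (base (column i)) successor (height i)

  height-world : ∀ h c → height (world h c) ≡ toℕ h
  height-world h c = cong (toℕ ∘ proj₁) (remQuot-combine {suc t} {suc g} h c)

  origin-world : ∀ h c → origin (world h c) ≡ fold (base c) successor (toℕ h)
  origin-world h c = cong₂ (λ c n → fold (base c) successor n)
    (cong proj₂ (remQuot-combine {suc t} {suc g} h c)) (height-world h c)

  root : Fin k
  root = world Fin.zero Fin.zero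

  top : Fin g → Fin k
  top j = world Fin.zero (Fin.suc j)

  origin-top : ∀ j → origin (top j) ≡ G j
  origin-top j = origin-world Fin.zero (Fin.suc j)

  child : (i : Fin k) → height i < t → Fin k
  child i lt = world (fromℕ< (s≤s lt)) (column i)

  height-child : ∀ i lt → height (child i lt) ≡ suc (height i)
  height-child i lt = trans (height-world (fromℕ< (s≤s lt)) (column i)) (toℕ-fromℕ< (s≤s lt))

  origin-child : ∀ i lt → origin (child i lt) ≡ successor (origin i)
  origin-child i lt = trans (origin-world (fromℕ< (s≤s lt)) (column i))
                            (cong (fold (base (column i)) successor) (toℕ-fromℕ< (s≤s lt)))

  Near : Fin k → Fin k → Set
  Near i v = height v ≤ suc (height i)

  near-top : ∀ i j → Near i (top j)
  near-top i j = subst (_≤ suc (height i)) (sym (height-world Fin.zero (Fin.suc j))) z≤n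

  Pair : Set
  Pair = Subset (Fin k) × Subset (Fin k)

  boxPair : Fin k → Fm → Pair
  boxPair i B = χ em (λ v → Near i v × Forces M (origin v) B)
              , χ em (λ v → ¬ T axM × Near i v × ¬ Forces M (origin v) B)

  leafPair : Fin k → Pair
  leafPair i = χ em (_≡ i) , λ _ → false

  nbCount : (i : Fin k) → Dec (height i < t) → ℕ
  nbCount i (yes _) = length (boxedAt (origin i))
  nbCount i (no _)  = 1

  nbAt : (i : Fin k) (d : Dec (height i < t)) → Fin (nbCount i d) → Pair
  nbAt i (yes _) c = boxPair i (lookup (boxedAt (origin i)) c)
  nbAt i (no _)  _ = leafPair i

  FM : FinModel
  FM = record
    { k  = k
    ; m  = λ i → nbCount i (height i <? t)
    ; nb = λ i → nbAt i (height i <? t)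
    ; V  = Model.V M ∘ origin
    }

  F : Model
  F = toModel FM

  top-∈-α : ∀ i B j → Forces M (G j) B → proj₁ (boxPair i B) (top j) ≡ true
  top-∈-α i B j GB = χ-true em (near-top i j , subst (λ y → Forces M y B) (sym (origin-top j)) GB)

  top-∈-β : ∀ i B j → ¬ T axM → ¬ Forces M (G j) B → proj₂ (boxPair i B) (top j) ≡ true
  top-∈-β i B j ¬m ¬GB =
    χ-true em (¬m , near-top i j , subst (λ y → ¬ Forces M y B) (sym (origin-top j)) ¬GB)

  Agree : Fin k → Fm → Set
  Agree v D = Forces F v D ⇔ Forces M (origin v) D

  boxPair-sandwich : ∀ i D → (∀ v → Near i v → Agree v D) → Sandwich F (boxPair i D) D
  boxPair-sandwich i D agree =
      (λ v v∈α → let (near , vD) = χ-true⁻ em v∈α in from (agree v near) vD)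
    , (λ v vD → χ-false em λ (_ , near , ¬vD) → ¬vD (to (agree v near) vD))

  boxPair-reflect : ∀ i B D → B ∈ args → D ∈ args → (∀ j → Forces F (top j) D ⇔ Forces M (G j) D) →
    Sandwich F (boxPair i B) D →
    (∀ y → Forces M y B → Forces M y D) × (¬ T axM → ∀ y → Forces M y D → Forces M y B)
  boxPair-reflect i B D B∈ D∈ agree (α⊆D , D∩β) = B⊆D , D⊆B
    where
    B⊆D : ∀ y → Forces M y B → Forces M y D
    B⊆D y yB with em {Forces M y D}
    ... | yes yD = yD
    ... | no ¬yD with realise₂ true B false D B∈ D∈ yB ¬yD
    ...   | j , GB , ¬GD = ⊥-elim (¬GD (to (agree j) (α⊆D (top j) (top-∈-α i B j GB))))

    D⊆B : ¬ T axM → ∀ y → Forces M y D → Forces M y B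
    D⊆B ¬m y yD with em {Forces M y B}
    ... | yes yB = yB
    ... | no ¬yB with realise₂ false B true D B∈ D∈ ¬yB yD
    ...   | j , ¬GB , GD with () ← trans (sym (top-∈-β i B j ¬m ¬GB)) (D∩β (top j) (from (agree j) GD))

  □-agree : ∀ i D → height i < t → D ∈ args → (∀ v → Near i v → Agree v D) → Agree i (□ D)
  □-agree i D lt D∈ agree = byLayer (height i <? t)
    where
    x : W
    x = origin i

    agreeTop : ∀ j → Forces F (top j) D ⇔ Forces M (G j) D
    agreeTop j = subst (λ y → Forces F (top j) D ⇔ Forces M y D) (origin-top j) (agree (top j) (near-top i j))

    reflect : ∀ c → Sandwich F (boxPair i (lookup (boxedAt x) c)) D → Forces M x (□ D)
    reflect c sw with boxedAt-□ x c | boxPair-reflect i _ D (boxedAt⊆args x c) D∈ agreeTop sw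
    ... | ix , α⊆B , B∩β | B⊆D , D⊆B = ix , (λ v v∈α → B⊆D v (α⊆B v v∈α)) , D∩β
      where
      D∩β : ∀ v → Forces M v D → proj₂ (nbᴹ x ix) v ≡ false
      D∩β v vD with T? axM
      ... | yes m  = condM m x ix v
      ... | no ¬m = B∩β v (D⊆B ¬m v vD)

    byLayer : (d : Dec (height i < t)) →
                (Σ (Fin (nbCount i d)) λ c → Sandwich F (nbAt i d c) D) ⇔ Forces M x (□ D)
    byLayer (no ¬lt) = ⊥-elim (¬lt lt)
    byLayer (yes _)  = mk⇔ (λ (c , sw) → reflect c sw) λ □D →
      let (c , B≡D) = index-boxedAt x D∈ □D
      in c , subst (λ B → Sandwich F (boxPair i B) D) (sym B≡D) (boxPair-sandwich i D agree)

  truth : ∀ D → boxArgs D ⊆ args → ∀ i → height i + size D ≤ t → Agree i D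
  truth (var _)  _  _ _   = ⇔-id _
  truth ⊥'       _  _ _   = ⇔-id _
  truth ⊤'       _  _ _   = ⇔-id _
  truth (a ∧' b) cl i bud =
    truth a (cl ∘ xs⊆xs++ys _ _) i (budget-left (height i) (size a) (size b) bud)
    ×-⇔ truth b (cl ∘ xs⊆ys++xs _ _) i (budget-right (height i) (size a) (size b) bud)
  truth (a ∨' b) cl i bud =
    truth a (cl ∘ xs⊆xs++ys _ _) i (budget-left (height i) (size a) (size b) bud)
    ⊎-⇔ truth b (cl ∘ xs⊆ys++xs _ _) i (budget-right (height i) (size a) (size b) bud)
  truth (a ⇒ b)  cl i bud = →-cong-⇔
    (truth a (cl ∘ xs⊆xs++ys _ _) i (budget-left (height i) (size a) (size b) bud))
    (truth b (cl ∘ xs⊆ys++xs _ _) i (budget-right (height i) (size a) (size b) bud))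
  truth (□ D)    cl i bud = □-agree i D (budget-□ (height i) (size D) bud) (cl (here refl)) λ v near →
    truth D (cl ∘ there) v (budget-next (height i) (size D) near bud)

  root-forces : Forces M w₀ A → Forces F root A
  root-forces w₀A = from (truth A there root (≤-reflexive (cong (_+ t) (height-world Fin.zero Fin.zero))))
                         (subst (λ y → Forces M y A) (sym (origin-world Fin.zero Fin.zero)) w₀A)

  sandwich-β : ∀ {y p B} → Sandwich M p B → proj₂ p y ≡ true → ¬ Forces M y B
  sandwich-β {y} (_ , B∩β) y∈β yB with () ← trans (sym y∈β) (B∩β y yB)

  F-condM : T axM → CondM F
  F-condM m i = byLayer (height i <? t)
    where
    byLayer : (d : Dec (height i < t)) (c : Fin (nbCount i d)) (v : Fin k) → proj₂ (nbAt i d c) v ≡ false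
    byLayer (yes _) c v = χ-false em λ (¬m , _) → ¬m m
    byLayer (no _)  _ _ = refl

  F-condN : T axN → CondN F
  F-condN n i = byLayer (height i <? t)
    where
    □⊤ : Forces M (origin i) (□ ⊤')
    □⊤ = let (ix , β∅) = condN n (origin i) in ix , (λ _ _ → _) , (λ v _ → β∅ v)

    byLayer : (d : Dec (height i < t)) → Σ (Fin (nbCount i d)) λ c → ∀ v → proj₂ (nbAt i d c) v ≡ false
    byLayer (yes _) = let (c , B≡⊤) = index-boxedAt (origin i) (here refl) □⊤ in
      c , λ v → subst (λ B → proj₂ (boxPair i B) v ≡ false) (sym B≡⊤) (χ-false em λ (_ , _ , ¬⊤) → ¬⊤ _)
    byLayer (no _)  = Fin.zero , λ _ → refl

  F-condT : T axT → CondT F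
  F-condT r i = byLayer (height i <? t)
    where
    byLayer : (d : Dec (height i < t)) (c : Fin (nbCount i d)) → proj₁ (nbAt i d c) i ≡ true
    byLayer (yes _) c = let (ix , α⊆B , _) = boxedAt-□ (origin i) c in
      χ-true em (n≤1+n (height i) , α⊆B (origin i) (condT r (origin i) ix))
    byLayer (no _)  _ = χ-true em refl

  F-condP : T axP → CondP F
  F-condP p i = byLayer (height i <? t)
    where
    byLayer : (d : Dec (height i < t)) (c : Fin (nbCount i d)) → Σ (Fin k) λ v → proj₁ (nbAt i d c) v ≡ true
    byLayer (yes _) c with boxedAt-□ (origin i) c
    ... | ix , α⊆B , _ with condP p (origin i) ix
    ...   | y , y∈α with realiseAll (λ _ → lookup (boxedAt (origin i)) c) (≤-trans (s≤s z≤n) 2≤K)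
                                    (λ _ → boxedAt⊆args (origin i) c) (y , λ _ → α⊆B y y∈α)
    ...     | j , GB = top j , top-∈-α i _ j (GB Fin.zero)
    byLayer (no _)  _ = i , χ-true em refl

  F-condD : T axD → CondD F
  F-condD r i = byLayer (height i <? t)
    where
    byLayer : (d : Dec (height i < t)) (c₁ c₂ : Fin (nbCount i d)) →
        (Σ (Fin k) λ v → (proj₁ (nbAt i d c₁) v ≡ true) × (proj₁ (nbAt i d c₂) v ≡ true))
      ⊎ (Σ (Fin k) λ v → (proj₂ (nbAt i d c₁) v ≡ true) × (proj₂ (nbAt i d c₂) v ≡ true))
    byLayer (no _) _ _ = inj₁ (i , χ-true em refl , χ-true em refl)
    byLayer (yes _) c₁ c₂
      with boxedAt⊆args (origin i) c₁ | boxedAt-□ (origin i) c₁ | boxedAt⊆args (origin i) c₂ | boxedAt-□ (origin i) c₂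
    ... | B₁∈ | ix₁ , sw₁ | B₂∈ | ix₂ , sw₂ with condD r (origin i) ix₁ ix₂
    ...   | inj₁ (y , y∈α₁ , y∈α₂) =
      let (j , G₁ , G₂) = realise₂ true _ true _ B₁∈ B₂∈ (proj₁ sw₁ y y∈α₁) (proj₁ sw₂ y y∈α₂)
      in inj₁ (top j , top-∈-α i _ j G₁ , top-∈-α i _ j G₂)
    ...   | inj₂ (y , y∈β₁ , y∈β₂) with T? axM
    ...     | yes m  with () ← trans (sym y∈β₁) (condM m (origin i) ix₁ y)
    ...     | no ¬m =
      let (j , ¬G₁ , ¬G₂) = realise₂ false _ false _ B₁∈ B₂∈ (sandwich-β sw₁ y∈β₁) (sandwich-β sw₂ y∈β₂)
      in inj₂ (top j , top-∈-β i _ j ¬m ¬G₁ , top-∈-β i _ j ¬m ¬G₂)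

  F-condRD : ∀ n → T (rdPlus n) → CondRD F (suc n)
  F-condRD n rdn i = byLayer (height i <? t)
    where
    byLayer : (d : Dec (height i < t)) (is : Fin (suc n) → Fin (nbCount i d)) →
          Σ (Fin k) λ v → ∀ c → proj₁ (nbAt i d (is c)) v ≡ true
    byLayer (no _)   _  = i , λ _ → χ-true em refl
    byLayer (yes lt) is = byShape rd
      where
      x : W
      x = origin i

      B : Fin (suc n) → Fm
      B c = lookup (boxedAt x) (is c)

      byShape : RDBoundedBy L K ⊎ RDUnbounded L → Σ (Fin k) λ v → ∀ c → proj₁ (boxPair i (B c)) v ≡ true
      byShape (inj₂ unbounded) = child i lt , λ c → χ-true em
        ( ≤-reflexive (height-child i lt)
        , subst (λ y → Forces M y (B c)) (sym (origin-child i lt))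
                (All.lookup (successor-forces unbounded x) (∈-lookup (is c))))
      byShape (inj₁ bounded) with condRD n rdn x (λ c → proj₁ (boxedAt-□ x (is c)))
      ... | y , y∈ with realiseAll B (bounded n rdn) (boxedAt⊆args x ∘ is)
                                   (y , λ c → proj₁ (proj₂ (boxedAt-□ x (is c))) y (y∈ c))
      ...   | j , GB = top j , λ c → top-∈-α i (B c) j (GB c)

  FM-for-L : ModelFor F L
  FM-for-L = F-condM , F-condN , F-condT , F-condD , F-condP , F-condRD

  nbCount-≤ : ∀ i d → nbCount i d ≤ length args
  nbCount-≤ i (yes _) = length-boxedAt (origin i)
  nbCount-≤ i (no _)  = s≤s z≤n

  size-FM : modelSize FM ≤ evalPoly (monomial (5 ^ (2 + K)) (2 + K)) t
  size-FM = begin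
    k + sumFin k (FinModel.m FM)  ≤⟨ +-monoʳ-≤ k (sumFin-≤ k _ λ i → nbCount-≤ i (height i <? t)) ⟩
    k + k * a                     ≡⟨ sym (*-suc k a) ⟩
    suc t * suc g * suc a         ≤⟨ *-mono-≤ (*-mono-≤ (below-5t (n≤1+n t)) g-bound) (below-5t a≤) ⟩
    5 * t * (5 * t) ^ K * (5 * t) ≡⟨ solve 2 (λ x y → x :* y :* x := x :* (x :* y)) refl (5 * t) ((5 * t) ^ K) ⟩
    (5 * t) ^ (2 + K)             ≡⟨ *-^-distrib 5 t (2 + K) ⟩
    5 ^ (2 + K) * t ^ (2 + K)     ≡⟨ evalPoly-monomial (5 ^ (2 + K)) (2 + K) t ⟨
    evalPoly (monomial (5 ^ (2 + K)) (2 + K)) t ∎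
    where
    open ≤-Reasoning

    a : ℕ
    a = length args

    a≤ : a ≤ suc t
    a≤ = s≤s (length-boxArgs A)

    5t-bound : suc (suc t + suc t) ≤ 5 * t
    5t-bound = 3+2t≤5t t (size-pos A)

    below-5t : ∀ {x} → x ≤ suc t → suc x ≤ 5 * t
    below-5t x≤ = ≤-trans (s≤s (≤-trans x≤ (m≤m+n (suc t) (suc t)))) 5t-bound

    g-bound : suc g ≤ (5 * t) ^ K
    g-bound = begin
      suc g               ≡⟨ cong suc g≡ ⟩
      suc ((a + a) ^ K)   ≤⟨ suc-^-≤ (a + a) K (≤-trans (s≤s z≤n) 2≤K) ⟩
      suc (a + a) ^ K     ≤⟨ ^-monoˡ-≤ K (≤-trans (s≤s (+-mono-≤ a≤ a≤)) 5t-bound) ⟩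
      (5 * t) ^ K         ∎

mainTheorem5 : ExcludedMiddle 0ℓ → (L : Logic) →
    Σ Poly λ p → (A : Fm) (M : Model) → ModelFor M L →
      (w : Model.W M) → Forces M w A →
      Σ FinModel λ F → ModelFor (toModel F) L
        × (Σ (Fin (FinModel.k F)) λ w′ → Forces (toModel F) w′ A)
        × (modelSize F ≤ evalPoly p (size A))
mainTheorem5 em L with rdProfile em L
... | K , 2≤K , rd = monomial (5 ^ (2 + K)) (2 + K) , λ A M (cM , cN , cT , cD , cP , cRD) w wA →
  let open Construction em L K 2≤K rd A M w cM cN cT cD cP cRD
  in FM , FM-for-L , (root , root-forces wA) , size-FM
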